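{- Let $\mathcal{C}$ be a stiff symmetric monoidal category, let $(T_u,\eta_u,\mu_u)_{u}$ be a formal monad on $\overline{\mathcal{C}}$ in $[\mathrm{ZI}(\mathcal{C})^{\mathrm{op}},\mathbf{Cat}]$, and let $u\leq v$ be central idempotents. Write $F=\mathcal{C}\|_{u\leq v}$, $G=\mathcal{C}|_{u\leq v}$, and $\eta^{u\leq v},\varepsilon^{u\leq v}$ for the unit and counit of $F\dashv G$. Then the monad $T_v$ is a localisable monad, with strength $\mathrm{st}_{A,U}\colon T_v(A)\otimes U\to T_v(A\otimes U)$ defined, for each object $A$ of $\mathcal{C}|_v$, as the composite in $\mathcal{C}|_v$ $$T_v(A)\otimes U=FGT_vA=FT_uGA\xrightarrow{FT_u\eta^{u\leq v}_{GA}}FT_uGFGA=FGT_vFGA\xrightarrow{\varepsilon^{u\leq v}_{T_vFGA}}T_vFGA=T_v(A\otimes U).$$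
   Context: Let $\mathcal{C}$ be a symmetric monoidal category with unit $I$, unitors $\lambda,\rho$, associator $\alpha$ and symmetry $\sigma$ (coherence isomorphisms often suppressed). A central idempotent is a morphism $u\colon U\to I$ such that $\rho_U\circ(U\otimes u)=\lambda_U\circ(u\otimes U)\colon U\otimes U\to U$ and this morphism is invertible; $u,v$ are identified when $u=v\circ m$ for an isomorphism $m$. $\mathrm{ZI}(\mathcal{C})$ is the meet-semilattice of central idempotents, $u\leq v$ iff $u=v\circ m$ for some morphism $m$, meet $u\otimes v$, top $\mathrm{id}_I$. $\mathcal{C}|_u$ is the symmetric monoidal category with the objects of $\mathcal{C}$, morphisms $A\to B$ being morphisms $A\otimes U\to B$, composition of $f\colon A\otimes U\to B$ and $g\colon B\otimes U\to C$ given by $g\circ(f\otimes U)\circ(A\otimes U\otimes u)^{ -1}$, identity $A\otimes u$, tensor of objects as in $\mathcal{C}$, tensor of morphisms $f,f'$ given by $(f\otimes f')\circ(A\otimes\sigma_{A',U}\otimes U)\circ(A\otimes A'\otimes U\otimes u)^{ -1}$. For $u\leq v$ with $u=v\circ m$: $\mathcal{C}|_{u\leq v}\colon\mathcal{C}|_v\to\mathcal{C}|_u$, $A\mapsto A$, $f\mapsto f\circ(A\otimes m)$; $\mathcal{C}\|_{u\leq v}\colon\mathcal{C}|_u\to\mathcal{C}|_v$, $A\mapsto A\otimes U$, $f\mapsto(f\otimes U)\circ(A\otimes u\otimes U)^{ -1}\circ(A\otimes U\otimes v)$; $\mathcal{C}\|_{u\leq v}\dashv\mathcal{C}|_{u\leq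 v}$. $\mathcal{C}$ is stiff when for every object $A$ and central idempotents $u,v$ the square with vertices $A\otimes U\otimes V$, $A\otimes V$, $A\otimes U$, $A$ (bottom edge $A\otimes u$, right edge $A\otimes v$) is a pullback. $\overline{\mathcal{C}}\colon\mathrm{ZI}(\mathcal{C})^{\mathrm{op}}\to\mathbf{Cat}$ sends $u\mapsto\mathcal{C}|_u$ and $(u\leq v)\mapsto\mathcal{C}|_{u\leq v}$; $[\mathrm{ZI}(\mathcal{C})^{\mathrm{op}},\mathbf{Cat}]$ has functors, natural transformations and modifications as 0-, 1- and 2-cells. A formal monad on $\overline{\mathcal{C}}$ amounts to a monad $(T_u,\eta_u,\mu_u)$ on $\mathcal{C}|_u$ for each central idempotent $u$ such that for all $u\leq v$: $T_u\circ\mathcal{C}|_{u\leq v}=\mathcal{C}|_{u\leq v}\circ T_v$ as functors, $(\eta_u)_{\mathcal{C}|_{u\leq v}A}=\mathcal{C}|_{u\leq v}((\eta_v)_A)$ and $(\mu_u)_{\mathcal{C}|_{u\leq v}A}=\mathcal{C}|_{u\leq v}((\mu_v)_A)$. A monad $(T,\eta,\mu)$ on a symmetric monoidal category $\mathcal{D}$ is localisable when there are morphisms $\mathrm{st}_{A,U}\colon T(A)\otimes U\to T(A\otimes U)$ for each object $A$ and central idempotent $u$ with: $T(\rho_A)\circ\mathrm{st}_{A,I}=\rho_{T(A)}$; $T(\alpha_{A,U,V})\circ\mathrm{st}_{A,U\otimes V}=\mathrm{st}_{A\otimes U,V}\circ(\mathrm{st}_{A,U}\otimes V)\circ\alpha_{TA,U,V}$;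 $\eta_{A\otimes U}=\mathrm{st}_{A,U}\circ(\eta_A\otimes U)$; $\mu_{A\otimes U}\circ T(\mathrm{st}_{A,U})\circ\mathrm{st}_{T(A),U}=\mathrm{st}_{A,U}\circ(\mu_A\otimes U)$; $\mathrm{st}_{A,V}\circ(T(A)\otimes m)=T(A\otimes m)\circ\mathrm{st}_{A,U}$ whenever $u=v\circ m$; $\mathrm{st}_{B,U}\circ(T(f)\otimes U)=T(f\otimes U)\circ\mathrm{st}_{A,U}$ for all $f\colon A\to B$. -}

module Defs where

open import Level using (Level; _⊔_) renaming (suc to lsuc)
open import Relation.Binary.PropositionalEquality using (_≡_; refl; subst₂; trans; cong)
open import Relation.Binary.Structures using (IsEquivalence)

record SymMonCat (o ℓ e : Level) : Set (lsuc (o ⊔ ℓ ⊔ e)) where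
  infixr 9 _∘_
  infix  4 _≈_
  infixr 10 _⊗₀_ _⊗₁_
  field
    Obj : Set o
    Hom : Obj → Obj → Set ℓ
    _≈_ : ∀ {A B} → Hom A B → Hom A B → Set e
    ≈-equiv : ∀ {A B} → IsEquivalence (_≈_ {A} {B})
    id  : ∀ {A} → Hom A A
    _∘_ : ∀ {A B C} → Hom B C → Hom A B → Hom A C
    assoc     : ∀ {A B C D} {f : Hom A B} {g : Hom B C} {h : Hom C D} →
                (h ∘ g) ∘ f ≈ h ∘ (g ∘ f)
    identityˡ : ∀ {A B} {f : Hom A B} → id ∘ f ≈ f
    identityʳ : ∀ {A B} {f : Hom A B} → f ∘ id ≈ f
    ∘-resp-≈  : ∀ {A B C} {f h : Hom B C} {g i : Hom A B} →
                f ≈ h → g ≈ i → f ∘ g ≈ h ∘ i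

    I     : Obj
    _⊗₀_  : Obj → Obj → Obj
    _⊗₁_  : ∀ {A B C D} → Hom A B → Hom C D → Hom (A ⊗₀ C) (B ⊗₀ D)
    ⊗-id  : ∀ {A B} → id {A} ⊗₁ id {B} ≈ id
    ⊗-∘   : ∀ {A B C D E F} {f : Hom B C} {g : Hom A B} {h : Hom E F} {k : Hom D E} →
            (f ∘ g) ⊗₁ (h ∘ k) ≈ (f ⊗₁ h) ∘ (g ⊗₁ k)
    ⊗-resp-≈ : ∀ {A B C D} {f g : Hom A B} {h k : Hom C D} →
               f ≈ g → h ≈ k → f ⊗₁ h ≈ g ⊗₁ k

    λ⇒ : ∀ {A} → Hom (I ⊗₀ A) A
    λ⇐ : ∀ {A} → Hom A (I ⊗₀ A)
    ρ⇒ : ∀ {A} → Hom (A ⊗₀ I) A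
    ρ⇐ : ∀ {A} → Hom A (A ⊗₀ I)
    α⇒ : ∀ {A B C} → Hom ((A ⊗₀ B) ⊗₀ C) (A ⊗₀ (B ⊗₀ C))
    α⇐ : ∀ {A B C} → Hom (A ⊗₀ (B ⊗₀ C)) ((A ⊗₀ B) ⊗₀ C)
    σ  : ∀ {A B} → Hom (A ⊗₀ B) (B ⊗₀ A)

    λ-isoˡ : ∀ {A} → λ⇐ {A} ∘ λ⇒ ≈ id
    λ-isoʳ : ∀ {A} → λ⇒ {A} ∘ λ⇐ ≈ id
    ρ-isoˡ : ∀ {A} → ρ⇐ {A} ∘ ρ⇒ ≈ id
    ρ-isoʳ : ∀ {A} → ρ⇒ {A} ∘ ρ⇐ ≈ id
    α-isoˡ : ∀ {A B C} → α⇐ {A} {B} {C} ∘ α⇒ ≈ id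
    α-isoʳ : ∀ {A B C} → α⇒ {A} {B} {C} ∘ α⇐ ≈ id
    σ-invol : ∀ {A B} → σ {B} {A} ∘ σ {A} {B} ≈ id

    λ-nat : ∀ {A B} {f : Hom A B} → f ∘ λ⇒ ≈ λ⇒ ∘ (id ⊗₁ f)
    ρ-nat : ∀ {A B} {f : Hom A B} → f ∘ ρ⇒ ≈ ρ⇒ ∘ (f ⊗₁ id)
    α-nat : ∀ {A B C D E F} {f : Hom A B} {g : Hom C D} {h : Hom E F} →
            (f ⊗₁ (g ⊗₁ h)) ∘ α⇒ ≈ α⇒ ∘ ((f ⊗₁ g) ⊗₁ h)
    σ-nat : ∀ {A B C D} {f : Hom A B} {g : Hom C D} →
            (g ⊗₁ f) ∘ σ ≈ σ ∘ (f ⊗₁ g)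

    triangle : ∀ {A B} → (id {A} ⊗₁ λ⇒ {B}) ∘ α⇒ ≈ ρ⇒ ⊗₁ id
    pentagon : ∀ {A B C D} →
               (id {A} ⊗₁ α⇒ {B} {C} {D}) ∘ (α⇒ ∘ (α⇒ ⊗₁ id)) ≈ α⇒ ∘ α⇒
    hexagon  : ∀ {A B C} →
               α⇒ {B} {C} {A} ∘ (σ {A} {B ⊗₀ C} ∘ α⇒) ≈ (id ⊗₁ σ) ∘ (α⇒ ∘ (σ ⊗₁ id))

module _ {o ℓ e : Level} (𝒞 : SymMonCat o ℓ e) where
  open SymMonCat 𝒞

  record CentralIdem (U : Obj) : Set (ℓ ⊔ e) where
    field
      mor     : Hom U I
      central : ρ⇒ ∘ (id ⊗₁ mor) ≈ λ⇒ ∘ (mor ⊗₁ id)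
      inv     : Hom U (U ⊗₀ U)
      inv-l   : (ρ⇒ ∘ (id ⊗₁ mor)) ∘ inv ≈ id
      inv-r   : inv ∘ (ρ⇒ ∘ (id ⊗₁ mor)) ≈ id
  open CentralIdem public

  _≤[_]_ : ∀ {U V} → CentralIdem U → Hom U V → CentralIdem V → Set e
  u ≤[ m ] v = mor u ≈ mor v ∘ m

  record IsPullback {P X Y Z : Obj} (p₁ : Hom P X) (p₂ : Hom P Y)
                   (f : Hom X Z) (g : Hom Y Z) : Set (o ⊔ ℓ ⊔ e) where
    field
      commute   : f ∘ p₁ ≈ g ∘ p₂
      universal : ∀ {Q} (h₁ : Hom Q X) (h₂ : Hom Q Y) → f ∘ h₁ ≈ g ∘ h₂ → Hom Q P
      univ-p₁   : ∀ {Q} {h₁ : Hom Q X} {h₂ : Hom Q Y} (eq : f ∘ h₁ ≈ g ∘ h₂) →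
                  p₁ ∘ universal h₁ h₂ eq ≈ h₁
      univ-p₂   : ∀ {Q} {h₁ : Hom Q X} {h₂ : Hom Q Y} (eq : f ∘ h₁ ≈ g ∘ h₂) →
                  p₂ ∘ universal h₁ h₂ eq ≈ h₂
      unique    : ∀ {Q} {h₁ : Hom Q X} {h₂ : Hom Q Y} (eq : f ∘ h₁ ≈ g ∘ h₂)
                  (k : Hom Q P) → p₁ ∘ k ≈ h₁ → p₂ ∘ k ≈ h₂ → k ≈ universal h₁ h₂ eq

  _⊗u_ : ∀ A {U} → CentralIdem U → Hom (A ⊗₀ U) A
  A ⊗u u = ρ⇒ ∘ (id {A} ⊗₁ mor u)

  Stiff : Set (o ⊔ ℓ ⊔ e)
  Stiff = ∀ (A : Obj) {U V} (u : CentralIdem U) (v : CentralIdem V) →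
          IsPullback ((A ⊗₀ U) ⊗u v) ((A ⊗u u) ⊗₁ id {V}) (A ⊗u u) (A ⊗u v)

  module Restrict {U : Obj} (u : CentralIdem U) where
    HomR : Obj → Obj → Set ℓ
    HomR A B = Hom (A ⊗₀ U) B

    -- (A ⊗ U ⊗ u)⁻¹ : A ⊗ U → (A ⊗ U) ⊗ U
    uinv : ∀ A → Hom (A ⊗₀ U) ((A ⊗₀ U) ⊗₀ U)
    uinv A = α⇐ ∘ (id {A} ⊗₁ inv u)

    idR : ∀ A → HomR A A
    idR A = A ⊗u u

    infixr 9 _∘R_
    _∘R_ : ∀ {A B C} → HomR B C → HomR A B → HomR A C
    _∘R_ {A} g f = g ∘ ((f ⊗₁ id {U}) ∘ uinv A)

    shuffle : ∀ A A' → Hom (((A ⊗₀ A') ⊗₀ U) ⊗₀ U) ((A ⊗₀ U) ⊗₀ (A' ⊗₀ U))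
    shuffle A A' = α⇐ ∘ ((id {A} ⊗₁ α⇒) ∘ ((id {A} ⊗₁ (σ {A'} {U} ⊗₁ id {U}))
                   ∘ ((id {A} ⊗₁ α⇐) ∘ (α⇒ ∘ α⇒))))

    infixr 10 _⊗R_
    _⊗R_ : ∀ {A B A' B'} → HomR A B → HomR A' B' → HomR (A ⊗₀ A') (B ⊗₀ B')
    _⊗R_ {A} {B} {A'} f f' = (f ⊗₁ f') ∘ (shuffle A A' ∘ uinv (A ⊗₀ A'))

    J : ∀ {A B} → Hom A B → HomR A B
    J {A} f = f ∘ idR A

    substR : ∀ {A A' B B'} → A ≡ A' → B ≡ B' → HomR A B → HomR A' B'
    substR = subst₂ HomR

    record MonadR : Set (o ⊔ ℓ ⊔ e) where
      field
        T₀ : Obj → Obj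
        T₁ : ∀ {A B} → HomR A B → HomR (T₀ A) (T₀ B)
        T-resp : ∀ {A B} {f g : HomR A B} → f ≈ g → T₁ f ≈ T₁ g
        T-id   : ∀ {A} → T₁ (idR A) ≈ idR (T₀ A)
        T-∘    : ∀ {A B C} {f : HomR A B} {g : HomR B C} → T₁ (g ∘R f) ≈ T₁ g ∘R T₁ f
        η : ∀ A → HomR A (T₀ A)
        μ : ∀ A → HomR (T₀ (T₀ A)) (T₀ A)
        η-nat : ∀ {A B} (f : HomR A B) → T₁ f ∘R η A ≈ η B ∘R f
        μ-nat : ∀ {A B} (f : HomR A B) → T₁ f ∘R μ A ≈ μ B ∘R T₁ (T₁ f)
        μ-assoc : ∀ A → μ A ∘R T₁ (μ A) ≈ μ A ∘R μ (T₀ A)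
        μ-unitˡ : ∀ A → μ A ∘R T₁ (η A) ≈ idR (T₀ A)
        μ-unitʳ : ∀ A → μ A ∘R η (T₀ A) ≈ idR (T₀ A)
  open Restrict public

  -- For u ≤ v via m:  G = C|_{u≤v} : C|_v → C|_u,  F = C‖_{u≤v} : C|_u → C|_v

  module _ {U V : Obj} (u : CentralIdem U) (v : CentralIdem V) (m : Hom U V) where
    G₁ : ∀ {A B} → HomR v A B → HomR u A B
    G₁ f = f ∘ (id ⊗₁ m)

    F₀ : Obj → Obj
    F₀ A = A ⊗₀ U

    F₁ : ∀ {A B} → HomR u A B → HomR v (F₀ A) (F₀ B)
    F₁ {A} f = (f ⊗₁ id {U}) ∘ (uinv u A ∘ ((A ⊗₀ U) ⊗u v))

    adj-unit : ∀ A → HomR u A (F₀ A)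
    adj-unit A = id

    adj-counit : ∀ B → HomR v (F₀ B) B
    adj-counit B = (B ⊗u u) ∘ ((B ⊗₀ U) ⊗u v)

  record FormalMonad : Set (o ⊔ ℓ ⊔ e) where
    field
      T : ∀ {U} (u : CentralIdem U) → MonadR u
    module TM {U} (u : CentralIdem U) = MonadR (T u)
    field
      -- T_u ∘ C|_{u≤v} = C|_{u≤v} ∘ T_v  (on objects and on morphisms)
      compat₀ : ∀ {U V} (u : CentralIdem U) (v : CentralIdem V) (m : Hom U V) →
                u ≤[ m ] v → ∀ A → TM.T₀ u A ≡ TM.T₀ v A
      compat₁ : ∀ {U V} (u : CentralIdem U) (v : CentralIdem V) (m : Hom U V) →
                (le : u ≤[ m ] v) → ∀ {A B} (f : HomR v A B) →
                substR u (compat₀ u v m le A) (compat₀ u v m le B)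
                       (TM.T₁ u (G₁ u v m f))
                  ≈ G₁ u v m (TM.T₁ v f)
      compat-η : ∀ {U V} (u : CentralIdem U) (v : CentralIdem V) (m : Hom U V) →
                 (le : u ≤[ m ] v) → ∀ A →
                 substR u refl (compat₀ u v m le A) (TM.η u A) ≈ G₁ u v m (TM.η v A)
      compat-μ : ∀ {U V} (u : CentralIdem U) (v : CentralIdem V) (m : Hom U V) →
                 (le : u ≤[ m ] v) → ∀ A →
                 substR u (trans (compat₀ u v m le (TM.T₀ u A))
                                 (cong (TM.T₀ v) (compat₀ u v m le A)))
                          (compat₀ u v m le A) (TM.μ u A)
                   ≈ G₁ u v m (TM.μ v A)

  module _ (M : FormalMonad) where
    open FormalMonad M

    prop-strength : ∀ {V} (v : CentralIdem V) {U} (u : CentralIdem U) (m : Hom U V) →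
                    u ≤[ m ] v → ∀ A →
                    HomR v (TM.T₀ v A ⊗₀ U) (TM.T₀ v (A ⊗₀ U))
    prop-strength v {U} u m le A =
      _∘R_ v (adj-counit u v m (TM.T₀ v (A ⊗₀ U)))
             (substR v (cong (_⊗₀ U) (compat₀ u v m le A))
                       (cong (_⊗₀ U) (compat₀ u v m le (A ⊗₀ U)))
                       (F₁ u v m (TM.T₁ u (adj-unit u v m A))))

  -- Localisable monads on C|_v.  Central idempotents of C|_v are taken to be
  -- (the images J(u) of) the central idempotents u ≤ v of C.

  module _ {V : Obj} (v : CentralIdem V) (Tm : MonadR v) where
    open MonadR Tm
    private
      _∘D_ : ∀ {A B C} → HomR v B C → HomR v A B → HomR v A C
      _∘D_ = _∘R_ v
      _⊗D_ : ∀ {A B A' B'} → HomR v A B → HomR v A' B' → HomR v (A ⊗₀ A') (B ⊗₀ B')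
      _⊗D_ = _⊗R_ v
      idD : ∀ A → HomR v A A
      idD = idR v
      JD : ∀ {A B} → Hom A B → HomR v A B
      JD = J v
      infixr 9 _∘D_
      infixr 10 _⊗D_

    Strength : Set (o ⊔ ℓ ⊔ e)
    Strength = ∀ {U} (u : CentralIdem U) (m : Hom U V) → u ≤[ m ] v → ∀ A →
               HomR v (T₀ A ⊗₀ U) (T₀ (A ⊗₀ U))

    record IsLocalisable (st : Strength) : Set (o ⊔ ℓ ⊔ e) where
      field
        -- T(ρ_A) ∘ st_{A,I} = ρ_{T A}, transported along the iso J(v) : V ≅ I of C|_v
        st-unit : ∀ A →
          T₁ (JD ρ⇒ ∘D (idD A ⊗D JD (mor v))) ∘D st v id (IsEquivalence.sym ≈-equiv identityʳ) A
            ≈ JD ρ⇒ ∘D (idD (T₀ A) ⊗D JD (mor v))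
        -- T(α) ∘ st_{A,U⊗W} = st_{A⊗U,W} ∘ (st_{A,U} ⊗ W) ∘ α  (α oriented A⊗(U⊗W) → (A⊗U)⊗W, as the types force)
        st-assoc : ∀ {U W} (u : CentralIdem U) (w : CentralIdem W)
          (uw : CentralIdem (U ⊗₀ W)) → mor uw ≈ λ⇒ ∘ (mor u ⊗₁ mor w) →
          (m : Hom U V) (lu : u ≤[ m ] v) (n : Hom W V) (lw : w ≤[ n ] v)
          (p : Hom (U ⊗₀ W) V) (luw : uw ≤[ p ] v) → ∀ A →
          T₁ (JD α⇐) ∘D st uw p luw A
            ≈ st w n lw (A ⊗₀ U) ∘D ((st u m lu A ⊗D idD W) ∘D JD α⇐)
        st-η : ∀ {U} (u : CentralIdem U) (m : Hom U V) (lu : u ≤[ m ] v) → ∀ A →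
          η (A ⊗₀ U) ≈ st u m lu A ∘D (η A ⊗D idD U)
        st-μ : ∀ {U} (u : CentralIdem U) (m : Hom U V) (lu : u ≤[ m ] v) → ∀ A →
          μ (A ⊗₀ U) ∘D (T₁ (st u m lu A) ∘D st u m lu (T₀ A))
            ≈ st u m lu A ∘D (μ A ⊗D idD U)
        st-le : ∀ {U W} (u : CentralIdem U) (w : CentralIdem W)
          (m : Hom U V) (lu : u ≤[ m ] v) (n : Hom W V) (lw : w ≤[ n ] v)
          (k : HomR v U W) → JD (mor u) ≈ JD (mor w) ∘D k → ∀ A →
          st w n lw A ∘D (idD (T₀ A) ⊗D k) ≈ T₁ (idD A ⊗D k) ∘D st u m lu A
        st-nat : ∀ {U} (u : CentralIdem U) (m : Hom U V) (lu : u ≤[ m ] v)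
          {A B} (f : HomR v A B) →
          st u m lu B ∘D (T₁ f ⊗D idD U) ≈ T₁ (f ⊗D idD U) ∘D st u m lu A

{-# OPTIONS --safe #-}
module Submission where

open import Level using (Level)
open import Relation.Binary.PropositionalEquality using (_≡_; refl; sym; trans; cong)
open import Relation.Binary.Structures using (IsEquivalence)
open import Defs

-- For u ≤ v, precomposing with the inverse of (X ⊗ U) ⊗ v : (X ⊗ U) ⊗ V → X ⊗ U turns a
-- morphism F X → Y of C|_v into a morphism X → G Y of C|_u; this is the left adjunct of F ⊣ G,
-- and it is injective. The left adjunct of st_A is T_u(η^{u≤v}_A), read through T_u A = T_v A.
-- Taking left adjuncts therefore turns every axiom of a localisable monad into a statement about
-- T_u alone, which follows from functoriality of T_u, naturality of its unit and multiplication,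
-- and the compatibility T_u ∘ G = G ∘ T_v of the formal monad, used also along u ≤ w ≤ v (for
-- st-le) and along u ⊗ w ≤ u, w (for st-assoc).

module HomReasoning {o ℓ ℓ≈ : Level} (𝒞 : SymMonCat o ℓ ℓ≈) where
  open SymMonCat 𝒞

  private
    variable
      A B C D X Y : Obj

  refl≈ : {f : Hom A B} → f ≈ f
  refl≈ = IsEquivalence.refl ≈-equiv

  sym≈ : {f g : Hom A B} → f ≈ g → g ≈ f
  sym≈ = IsEquivalence.sym ≈-equiv

  infixr 4 _○_
  _○_ : {f g h : Hom A B} → f ≈ g → g ≈ h → f ≈ h
  _○_ = IsEquivalence.trans ≈-equiv

  ≡⇒≈ : {f g : Hom A B} → f ≡ g → f ≈ g
  ≡⇒≈ refl = refl≈

  infix  3 _∎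
  infixr 2 _≈⟨_⟩_ _≈˘⟨_⟩_
  infix  1 begin_

  begin_ : {f g : Hom A B} → f ≈ g → f ≈ g
  begin p = p

  _≈⟨_⟩_ : (f : Hom A B) {g h : Hom A B} → f ≈ g → g ≈ h → f ≈ h
  f ≈⟨ p ⟩ q = p ○ q

  _≈˘⟨_⟩_ : (f : Hom A B) {g h : Hom A B} → g ≈ f → g ≈ h → f ≈ h
  f ≈˘⟨ p ⟩ q = sym≈ p ○ q

  _∎ : (f : Hom A B) → f ≈ f
  f ∎ = refl≈

  infixr 5 _⟩∘⟨_ _⟩⊗⟨_ refl⟩∘⟨_ refl⟩⊗⟨_
  infixl 6 _⟩∘⟨refl _⟩⊗⟨refl

  _⟩∘⟨_ : {f h : Hom B C} {g i : Hom A B} → f ≈ h → g ≈ i → f ∘ g ≈ h ∘ i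
  _⟩∘⟨_ = ∘-resp-≈

  _⟩⊗⟨_ : {f g : Hom A B} {h k : Hom C D} → f ≈ g → h ≈ k → f ⊗₁ h ≈ g ⊗₁ k
  _⟩⊗⟨_ = ⊗-resp-≈

  refl⟩∘⟨_ : {f : Hom B C} {g i : Hom A B} → g ≈ i → f ∘ g ≈ f ∘ i
  refl⟩∘⟨ p = refl≈ ⟩∘⟨ p

  _⟩∘⟨refl : {f h : Hom B C} {g : Hom A B} → f ≈ h → f ∘ g ≈ h ∘ g
  p ⟩∘⟨refl = p ⟩∘⟨ refl≈

  refl⟩⊗⟨_ : {f : Hom A B} {h k : Hom C D} → h ≈ k → f ⊗₁ h ≈ f ⊗₁ k
  refl⟩⊗⟨ p = refl≈ ⟩⊗⟨ p

  _⟩⊗⟨refl : {f g : Hom A B} {h : Hom C D} → f ≈ g → f ⊗₁ h ≈ g ⊗₁ h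
  p ⟩⊗⟨refl = p ⟩⊗⟨ refl≈

  sym-assoc : {f : Hom A B} {g : Hom B C} {h : Hom C D} → h ∘ (g ∘ f) ≈ (h ∘ g) ∘ f
  sym-assoc = sym≈ assoc

  module _ {a : Hom B C} {b : Hom A B} {c : Hom A C} (ab≈c : a ∘ b ≈ c) where
    pullˡ : {f : Hom X A} → a ∘ (b ∘ f) ≈ c ∘ f
    pullˡ = sym-assoc ○ ab≈c ⟩∘⟨refl

    pullʳ : {f : Hom C X} → (f ∘ a) ∘ b ≈ f ∘ c
    pullʳ = assoc ○ refl⟩∘⟨ ab≈c

  module _ {a : Hom B A} {b : Hom A B} (ab≈id : a ∘ b ≈ id) where
    cancelˡ : {f : Hom X A} → a ∘ (b ∘ f) ≈ f
    cancelˡ = pullˡ ab≈id ○ identityˡ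

    cancelʳ : {f : Hom A X} → (f ∘ a) ∘ b ≈ f
    cancelʳ = pullʳ ab≈id ○ identityʳ

  elimˡ : {a : Hom B B} {f : Hom A B} → a ≈ id → a ∘ f ≈ f
  elimˡ p = p ⟩∘⟨refl ○ identityˡ

  elimʳ : {a : Hom A A} {f : Hom A B} → a ≈ id → f ∘ a ≈ f
  elimʳ p = refl⟩∘⟨ p ○ identityʳ

  split-mono : {a : Hom B C} {a' : Hom C B} → a' ∘ a ≈ id →
               {f g : Hom A B} → a ∘ f ≈ a ∘ g → f ≈ g
  split-mono p q = sym≈ (cancelˡ p) ○ refl⟩∘⟨ q ○ cancelˡ p

  split-epi : {a : Hom A B} {a' : Hom B A} → a ∘ a' ≈ id →
              {f g : Hom B C} → f ∘ a ≈ g ∘ a → f ≈ g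
  split-epi p q = sym≈ (cancelʳ p) ○ q ⟩∘⟨refl ○ cancelʳ p

module MonoidalProperties {o ℓ ℓ≈ : Level} (𝒞 : SymMonCat o ℓ ℓ≈) where
  open SymMonCat 𝒞
  open HomReasoning 𝒞

  private
    variable
      A B C D E F : Obj

  ⊗-∘ˡ : {f : Hom B C} {g : Hom A B} → (f ∘ g) ⊗₁ id {D} ≈ (f ⊗₁ id) ∘ (g ⊗₁ id)
  ⊗-∘ˡ = (refl⟩⊗⟨ sym≈ identityˡ) ○ ⊗-∘

  ⊗-∘ʳ : {f : Hom B C} {g : Hom A B} → id {D} ⊗₁ (f ∘ g) ≈ (id ⊗₁ f) ∘ (id ⊗₁ g)
  ⊗-∘ʳ = (sym≈ identityˡ ⟩⊗⟨refl) ○ ⊗-∘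

  ⊗-split₁ : {f : Hom A B} {g : Hom C D} → f ⊗₁ g ≈ (f ⊗₁ id) ∘ (id ⊗₁ g)
  ⊗-split₁ = (sym≈ identityʳ ⟩⊗⟨ sym≈ identityˡ) ○ ⊗-∘

  ⊗-split₂ : {f : Hom A B} {g : Hom C D} → f ⊗₁ g ≈ (id ⊗₁ g) ∘ (f ⊗₁ id)
  ⊗-split₂ = (sym≈ identityˡ ⟩⊗⟨ sym≈ identityʳ) ○ ⊗-∘

  ⊗-elim : {f : Hom A A} {h : Hom B B} → f ≈ id → h ≈ id → f ⊗₁ h ≈ id
  ⊗-elim p q = (p ⟩⊗⟨ q) ○ ⊗-id

  α-natʳ : {h : Hom C D} → (id {A} ⊗₁ (id {B} ⊗₁ h)) ∘ α⇒ ≈ α⇒ ∘ (id ⊗₁ h)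
  α-natʳ = α-nat ○ refl⟩∘⟨ (⊗-id ⟩⊗⟨refl)

  α-natˡ : {f : Hom A D} → (f ⊗₁ id {B ⊗₀ C}) ∘ α⇒ ≈ α⇒ ∘ (f ⊗₁ id) ⊗₁ id
  α-natˡ = (refl⟩⊗⟨ sym≈ ⊗-id) ⟩∘⟨refl ○ α-nat

  α⇐-nat : {f : Hom A B} {g : Hom C D} {h : Hom E F} →
           ((f ⊗₁ g) ⊗₁ h) ∘ α⇐ ≈ α⇐ ∘ (f ⊗₁ (g ⊗₁ h))
  α⇐-nat = sym≈ (cancelˡ α-isoˡ)
         ○ refl⟩∘⟨ (sym-assoc ○ (sym≈ α-nat ⟩∘⟨refl) ○ assoc ○ elimʳ α-isoʳ)

  α⇐-natʳ : {h : Hom C D} → (id {A ⊗₀ B} ⊗₁ h) ∘ α⇐ ≈ α⇐ ∘ (id ⊗₁ (id ⊗₁ h))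
  α⇐-natʳ = (sym≈ ⊗-id ⟩⊗⟨refl) ⟩∘⟨refl ○ α⇐-nat

  -⊗I-faithful : {f g : Hom A B} → f ⊗₁ id {I} ≈ g ⊗₁ id → f ≈ g
  -⊗I-faithful p = sym≈ (cancelʳ ρ-isoʳ) ○ ρ-nat ⟩∘⟨refl ○ (refl⟩∘⟨ p ○ sym≈ ρ-nat) ⟩∘⟨refl
                 ○ cancelʳ ρ-isoʳ

  I⊗-faithful : {f g : Hom A B} → id {I} ⊗₁ f ≈ id ⊗₁ g → f ≈ g
  I⊗-faithful p = sym≈ (cancelʳ λ-isoʳ) ○ λ-nat ⟩∘⟨refl ○ (refl⟩∘⟨ p ○ sym≈ λ-nat) ⟩∘⟨refl
                ○ cancelʳ λ-isoʳ

  ρ⇒∘α⇒ : (id {A} ⊗₁ ρ⇒ {B}) ∘ α⇒ ≈ ρ⇒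
  ρ⇒∘α⇒ {A} {B} = sym≈ (-⊗I-faithful (split-mono α-isoˡ pentagon-reduced))
    where
    pentagon-reduced : α⇒ ∘ (ρ⇒ {A ⊗₀ B} ⊗₁ id) ≈ α⇒ ∘ (((id ⊗₁ ρ⇒) ∘ α⇒) ⊗₁ id)
    pentagon-reduced = begin
      α⇒ ∘ (ρ⇒ ⊗₁ id)                        ≈˘⟨ refl⟩∘⟨ triangle ⟩
      α⇒ ∘ ((id ⊗₁ λ⇒) ∘ α⇒)                 ≈⟨ sym-assoc ○ (refl⟩∘⟨ (sym≈ ⊗-id ⟩⊗⟨refl)) ⟩∘⟨refl ⟩
      (α⇒ ∘ ((id ⊗₁ id) ⊗₁ λ⇒)) ∘ α⇒         ≈˘⟨ α-nat ⟩∘⟨refl ⟩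
      ((id ⊗₁ (id ⊗₁ λ⇒)) ∘ α⇒) ∘ α⇒         ≈⟨ assoc ○ refl⟩∘⟨ sym≈ pentagon ⟩
      (id ⊗₁ (id ⊗₁ λ⇒)) ∘ ((id ⊗₁ α⇒) ∘ (α⇒ ∘ (α⇒ ⊗₁ id)))
                                              ≈⟨ pullˡ (sym≈ ⊗-∘ʳ) ○ (refl⟩⊗⟨ triangle) ⟩∘⟨refl ⟩
      (id ⊗₁ (ρ⇒ ⊗₁ id)) ∘ (α⇒ ∘ (α⇒ ⊗₁ id)) ≈⟨ pullˡ α-nat ○ assoc ⟩
      α⇒ ∘ (((id ⊗₁ ρ⇒) ⊗₁ id) ∘ (α⇒ ⊗₁ id)) ≈˘⟨ refl⟩∘⟨ ⊗-∘ˡ ⟩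
      α⇒ ∘ (((id ⊗₁ ρ⇒) ∘ α⇒) ⊗₁ id)         ∎

  λ⇒∘α⇒ : λ⇒ {A ⊗₀ B} ∘ α⇒ ≈ λ⇒ ⊗₁ id
  λ⇒∘α⇒ {A} {B} = I⊗-faithful (split-epi α∘α-inverse pentagon-reduced)
    where
    α∘α-inverse : (α⇒ {I} {I ⊗₀ A} {B} ∘ (α⇒ ⊗₁ id)) ∘ ((α⇐ ⊗₁ id) ∘ α⇐) ≈ id
    α∘α-inverse = pullʳ (cancelˡ (sym≈ ⊗-∘ ○ ⊗-elim α-isoʳ identityˡ)) ○ α-isoʳ
    pentagon-reduced : (id ⊗₁ (λ⇒ ∘ α⇒)) ∘ (α⇒ ∘ (α⇒ ⊗₁ id))
                     ≈ (id ⊗₁ (λ⇒ ⊗₁ id)) ∘ (α⇒ ∘ (α⇒ ⊗₁ id))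
    pentagon-reduced = begin
      (id ⊗₁ (λ⇒ ∘ α⇒)) ∘ (α⇒ ∘ (α⇒ ⊗₁ id))    ≈⟨ ⊗-∘ʳ ⟩∘⟨refl ○ assoc ○ refl⟩∘⟨ pentagon ⟩
      (id ⊗₁ λ⇒) ∘ (α⇒ ∘ α⇒)                   ≈⟨ pullˡ triangle ⟩
      (ρ⇒ ⊗₁ id) ∘ α⇒                          ≈⟨ (refl⟩⊗⟨ sym≈ ⊗-id) ⟩∘⟨refl ○ α-nat ⟩
      α⇒ ∘ ((ρ⇒ ⊗₁ id) ⊗₁ id)                  ≈˘⟨ refl⟩∘⟨ (triangle ⟩⊗⟨refl) ⟩
      α⇒ ∘ (((id ⊗₁ λ⇒) ∘ α⇒) ⊗₁ id)           ≈⟨ refl⟩∘⟨ ⊗-∘ˡ ⟩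
      α⇒ ∘ (((id ⊗₁ λ⇒) ⊗₁ id) ∘ (α⇒ ⊗₁ id))   ≈⟨ pullˡ (sym≈ α-nat) ○ assoc ⟩
      (id ⊗₁ (λ⇒ ⊗₁ id)) ∘ (α⇒ ∘ (α⇒ ⊗₁ id))   ∎

  λ⇒∘σ : λ⇒ ∘ σ {A} {I} ≈ ρ⇒
  λ⇒∘σ {A} = -⊗I-faithful (split-mono σ-invol hexagon-reduced)
    where
    hexagon-reduced : σ ∘ (λ⇒ ∘ σ {A} {I}) ⊗₁ id {I} ≈ σ ∘ (ρ⇒ ⊗₁ id)
    hexagon-reduced = begin
      σ ∘ ((λ⇒ ∘ σ) ⊗₁ id)                   ≈⟨ refl⟩∘⟨ ⊗-∘ˡ ⟩
      σ ∘ ((λ⇒ ⊗₁ id) ∘ (σ ⊗₁ id))           ≈˘⟨ refl⟩∘⟨ pullˡ λ⇒∘α⇒ ⟩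
      σ ∘ (λ⇒ ∘ (α⇒ ∘ (σ ⊗₁ id)))            ≈⟨ pullˡ λ-nat ○ assoc ⟩
      λ⇒ ∘ ((id ⊗₁ σ) ∘ (α⇒ ∘ (σ ⊗₁ id)))    ≈˘⟨ refl⟩∘⟨ hexagon ⟩
      λ⇒ ∘ (α⇒ ∘ (σ ∘ α⇒))                   ≈⟨ pullˡ λ⇒∘α⇒ ⟩
      (λ⇒ ⊗₁ id) ∘ (σ ∘ α⇒)                  ≈⟨ pullˡ σ-nat ⟩
      (σ ∘ (id ⊗₁ λ⇒)) ∘ α⇒                  ≈⟨ pullʳ triangle ⟩
      σ ∘ (ρ⇒ ⊗₁ id)                         ∎

  ρ⇒∘σ : ρ⇒ ∘ σ {I} {A} ≈ λ⇒
  ρ⇒∘σ = sym≈ (λ⇒∘σ ⟩∘⟨refl) ○ cancelʳ σ-invol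

  ρ⇒I≈λ⇒I : ρ⇒ {I} ≈ λ⇒
  ρ⇒I≈λ⇒I = I⊗-faithful (split-epi α-isoʳ (ρ⇒∘α⇒ ○ split-mono ρ-isoˡ ρ-nat ○ sym≈ triangle))

  ρ⇒⊗id∘α⇐ : (ρ⇒ {A} ⊗₁ id {B}) ∘ α⇐ ≈ id ⊗₁ λ⇒
  ρ⇒⊗id∘α⇐ = sym≈ triangle ⟩∘⟨refl ○ cancelʳ α-isoʳ

module _ {o ℓ ℓ≈ : Level} {𝒞 : SymMonCat o ℓ ℓ≈} where
  open SymMonCat 𝒞
  open HomReasoning 𝒞
  open MonoidalProperties 𝒞

  module CentralIdempotent {U : Obj} (u : CentralIdem 𝒞 U) where
    private
      variable
        A B C X Y Z : Obj

    υ : Hom U I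
    υ = mor u

    δ : Hom (U ⊗₀ U) U
    δ = ρ⇒ ∘ (id ⊗₁ υ)

    ι : Hom U (U ⊗₀ U)
    ι = inv u

    δ∘ι : δ ∘ ι ≈ id
    δ∘ι = inv-l u

    ι∘δ : ι ∘ δ ≈ id
    ι∘δ = inv-r u

    e : ∀ X → Hom (X ⊗₀ U) X
    e X = _⊗u_ 𝒞 X u

    e⁻¹ : ∀ X → Hom (X ⊗₀ U) ((X ⊗₀ U) ⊗₀ U)
    e⁻¹ = uinv 𝒞 u

    e-natural : {f : Hom X Y} → f ∘ e X ≈ e Y ∘ (f ⊗₁ id)
    e-natural = pullˡ ρ-nat ○ assoc ○ refl⟩∘⟨ (sym≈ ⊗-split₁ ○ ⊗-split₂) ○ sym-assoc

    e-assoc : e (X ⊗₀ Y) ≈ (id ⊗₁ e Y) ∘ α⇒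
    e-assoc = sym≈ ρ⇒∘α⇒ ⟩∘⟨refl ○ assoc ○ refl⟩∘⟨ sym≈ α-natʳ ○ pullˡ (sym≈ ⊗-∘ʳ)

    e∘e⁻¹ : e (X ⊗₀ U) ∘ e⁻¹ X ≈ id
    e∘e⁻¹ = e-assoc ⟩∘⟨refl ○ pullʳ (cancelˡ α-isoʳ) ○ sym≈ ⊗-∘ʳ ○ ⊗-elim refl≈ δ∘ι

    e⁻¹∘e : e⁻¹ X ∘ e (X ⊗₀ U) ≈ id
    e⁻¹∘e = refl⟩∘⟨ e-assoc ○ pullʳ (pullˡ (sym≈ ⊗-∘ʳ ○ ⊗-elim refl≈ ι∘δ) ○ identityˡ) ○ α-isoˡ

    e⁻¹-natural : (h : Hom (X ⊗₀ U) (Y ⊗₀ U)) → e⁻¹ Y ∘ h ≈ (h ⊗₁ id) ∘ e⁻¹ X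
    e⁻¹-natural h = refl⟩∘⟨ (sym≈ (elimʳ e∘e⁻¹) ○ sym-assoc ○ e-natural ⟩∘⟨refl ○ assoc)
                  ○ cancelˡ e⁻¹∘e

    e⊗-∘α⇐ : {g : Hom Y Z} → (e X ⊗₁ g) ∘ α⇐ ≈ id ⊗₁ (g ∘ (λ⇒ ∘ (υ ⊗₁ id)))
    e⊗-∘α⇐ {g = g} = begin
      ((ρ⇒ ∘ (id ⊗₁ υ)) ⊗₁ g) ∘ α⇐                         ≈⟨ ⊗-split₂ ⟩∘⟨refl ○ assoc ⟩
      (id ⊗₁ g) ∘ (((ρ⇒ ∘ (id ⊗₁ υ)) ⊗₁ id) ∘ α⇐)          ≈⟨ refl⟩∘⟨ (⊗-∘ˡ ⟩∘⟨refl ○ assoc) ⟩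
      (id ⊗₁ g) ∘ ((ρ⇒ ⊗₁ id) ∘ (((id ⊗₁ υ) ⊗₁ id) ∘ α⇐))  ≈⟨ refl⟩∘⟨ refl⟩∘⟨ α⇐-nat ⟩
      (id ⊗₁ g) ∘ ((ρ⇒ ⊗₁ id) ∘ (α⇐ ∘ (id ⊗₁ (υ ⊗₁ id))))  ≈⟨ refl⟩∘⟨ pullˡ ρ⇒⊗id∘α⇐ ⟩
      (id ⊗₁ g) ∘ ((id ⊗₁ λ⇒) ∘ (id ⊗₁ (υ ⊗₁ id)))         ≈˘⟨ refl⟩∘⟨ ⊗-∘ʳ ⟩
      (id ⊗₁ g) ∘ (id ⊗₁ (λ⇒ ∘ (υ ⊗₁ id)))                 ≈˘⟨ ⊗-∘ʳ ⟩
      id ⊗₁ (g ∘ (λ⇒ ∘ (υ ⊗₁ id)))                         ∎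

    λ⇒∘υ⊗id∘σ : λ⇒ ∘ ((υ ⊗₁ id) ∘ σ {X} {U}) ≈ e X
    λ⇒∘υ⊗id∘σ = refl⟩∘⟨ σ-nat ○ pullˡ λ⇒∘σ

    e⊗id∘e⁻¹ : (e X ⊗₁ id) ∘ e⁻¹ X ≈ id
    e⊗id∘e⁻¹ = sym-assoc ○ (e⊗-∘α⇐ ○ (refl⟩⊗⟨ identityˡ)) ⟩∘⟨refl ○ sym≈ ⊗-∘ʳ
             ○ ⊗-elim refl≈ (sym≈ (central u) ⟩∘⟨refl ○ δ∘ι)

    σ∘ι : σ ∘ ι ≈ ι
    σ∘ι = sym≈ (elimˡ ι∘δ) ○ assoc ○ refl⟩∘⟨ pullˡ δ∘σ ○ refl⟩∘⟨ δ∘ι ○ identityʳ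
      where
      δ∘σ : δ ∘ σ ≈ δ
      δ∘σ = assoc ○ refl⟩∘⟨ σ-nat ○ pullˡ ρ⇒∘σ ○ sym≈ (central u)

    e⊗id≈e : e X ⊗₁ id {U} ≈ e (X ⊗₀ U)
    e⊗id≈e = ⊗-∘ˡ ○ (sym≈ triangle ⟩∘⟨refl) ○ assoc ○ refl⟩∘⟨ sym≈ α-nat ○ pullˡ (sym≈ ⊗-∘ʳ)
           ○ (refl⟩⊗⟨ sym≈ (central u)) ⟩∘⟨refl ○ sym≈ e-assoc

    infixr 9 _∘ᵤ_
    infixr 10 _⊗ᵤ_

    _∘ᵤ_ : HomR 𝒞 u B C → HomR 𝒞 u A B → HomR 𝒞 u A C
    _∘ᵤ_ = _∘R_ 𝒞 u

    idᵤ : ∀ A → HomR 𝒞 u A A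
    idᵤ = idR 𝒞 u

    _⊗ᵤ_ : ∀ {A B A' B'} → HomR 𝒞 u A B → HomR 𝒞 u A' B' → HomR 𝒞 u (A ⊗₀ A') (B ⊗₀ B')
    _⊗ᵤ_ = _⊗R_ 𝒞 u

    Jᵤ : Hom A B → HomR 𝒞 u A B
    Jᵤ = J 𝒞 u

    ∘ᵤ-resp-≈ : {f h : HomR 𝒞 u B C} {g i : HomR 𝒞 u A B} → f ≈ h → g ≈ i → f ∘ᵤ g ≈ h ∘ᵤ i
    ∘ᵤ-resp-≈ p q = p ⟩∘⟨ (q ⟩⊗⟨refl) ⟩∘⟨refl

    ∘ᵤ-assoc : {f : HomR 𝒞 u A B} {g : HomR 𝒞 u B C} {h : HomR 𝒞 u C X} →
               (h ∘ᵤ g) ∘ᵤ f ≈ h ∘ᵤ (g ∘ᵤ f)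
    ∘ᵤ-assoc {A} {f = f} {g} {h} = assoc ○ refl⟩∘⟨ sym≈ (begin
      ((g ∘ ((f ⊗₁ id) ∘ e⁻¹ A)) ⊗₁ id) ∘ e⁻¹ A                ≈⟨ (⊗-∘ˡ ○ refl⟩∘⟨ ⊗-∘ˡ) ⟩∘⟨refl ⟩
      ((g ⊗₁ id) ∘ (((f ⊗₁ id) ⊗₁ id) ∘ (e⁻¹ A ⊗₁ id))) ∘ e⁻¹ A ≈⟨ assoc ○ refl⟩∘⟨ assoc ⟩
      (g ⊗₁ id) ∘ (((f ⊗₁ id) ⊗₁ id) ∘ ((e⁻¹ A ⊗₁ id) ∘ e⁻¹ A)) ≈˘⟨ refl⟩∘⟨ refl⟩∘⟨ e⁻¹-natural (e⁻¹ A) ⟩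
      (g ⊗₁ id) ∘ (((f ⊗₁ id) ⊗₁ id) ∘ (e⁻¹ (A ⊗₀ U) ∘ e⁻¹ A))  ≈⟨ refl⟩∘⟨ pullˡ (sym≈ (e⁻¹-natural (f ⊗₁ id))) ⟩
      (g ⊗₁ id) ∘ ((e⁻¹ _ ∘ (f ⊗₁ id)) ∘ e⁻¹ A)                 ≈⟨ refl⟩∘⟨ assoc ○ sym-assoc ⟩
      ((g ⊗₁ id) ∘ e⁻¹ _) ∘ ((f ⊗₁ id) ∘ e⁻¹ A)                 ∎)

    Jᵤ-∘ᵤ : {x : Hom B C} {h : HomR 𝒞 u A B} → Jᵤ x ∘ᵤ h ≈ x ∘ h
    Jᵤ-∘ᵤ = assoc ○ refl⟩∘⟨ (pullˡ (sym≈ e-natural) ○ assoc ○ elimʳ e∘e⁻¹)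

    private
      τ : ∀ X → Hom (X ⊗₀ U) (U ⊗₀ (X ⊗₀ U))
      τ X = α⇒ ∘ ((σ {X} {U} ⊗₁ id) ∘ e⁻¹ X)

      shuffle∘e⁻¹ : shuffle 𝒞 u A B ∘ e⁻¹ (A ⊗₀ B) ≈ α⇐ ∘ ((id ⊗₁ τ B) ∘ α⇒)
      shuffle∘e⁻¹ = assoc ○ refl⟩∘⟨ (assoc ○ refl⟩∘⟨ (assoc ○ refl⟩∘⟨ (assoc ○ refl⟩∘⟨ (
                      assoc ○ refl⟩∘⟨ cancelˡ α-isoʳ ○ sym≈ α-natʳ)
                      ○ pullˡ (sym≈ ⊗-∘ʳ)) ○ pullˡ (sym≈ ⊗-∘ʳ)) ○ pullˡ (sym≈ ⊗-∘ʳ))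

      λ⇒∘υ⊗id∘τ : λ⇒ ∘ ((υ ⊗₁ id) ∘ τ X) ≈ id
      λ⇒∘υ⊗id∘τ = begin
        λ⇒ ∘ ((υ ⊗₁ id) ∘ (α⇒ ∘ ((σ ⊗₁ id) ∘ e⁻¹ _)))           ≈⟨ refl⟩∘⟨ (pullˡ α-natˡ ○ assoc) ⟩
        λ⇒ ∘ (α⇒ ∘ (((υ ⊗₁ id) ⊗₁ id) ∘ ((σ ⊗₁ id) ∘ e⁻¹ _)))   ≈⟨ pullˡ λ⇒∘α⇒ ⟩
        (λ⇒ ⊗₁ id) ∘ (((υ ⊗₁ id) ⊗₁ id) ∘ ((σ ⊗₁ id) ∘ e⁻¹ _))  ≈⟨ refl⟩∘⟨ sym-assoc ○ sym-assoc ⟩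
        ((λ⇒ ⊗₁ id) ∘ (((υ ⊗₁ id) ⊗₁ id) ∘ (σ ⊗₁ id))) ∘ e⁻¹ _ ≈⟨ (refl⟩∘⟨ sym≈ ⊗-∘ˡ ○ sym≈ ⊗-∘ˡ) ⟩∘⟨refl ⟩
        ((λ⇒ ∘ ((υ ⊗₁ id) ∘ σ)) ⊗₁ id) ∘ e⁻¹ _                  ≈⟨ (λ⇒∘υ⊗id∘σ ⟩⊗⟨refl) ⟩∘⟨refl ○ e⊗id∘e⁻¹ ⟩
        id                                                      ∎

      id⊗e∘τ : (id ⊗₁ e X) ∘ τ X ≈ σ
      id⊗e∘τ = pullˡ (sym≈ e-assoc) ○ sym-assoc ○ sym≈ e-natural ⟩∘⟨refl ○ assoc ○ elimʳ e∘e⁻¹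

    idᵤ⊗ᵤ : {g : HomR 𝒞 u B C} → idᵤ A ⊗ᵤ g ≈ (id ⊗₁ g) ∘ α⇒
    idᵤ⊗ᵤ = refl⟩∘⟨ shuffle∘e⁻¹ ○ pullˡ e⊗-∘α⇐ ○ pullˡ (sym≈ ⊗-∘ʳ)
          ○ (refl⟩⊗⟨ (assoc ○ elimʳ (assoc ○ λ⇒∘υ⊗id∘τ))) ⟩∘⟨refl

    exchange : ∀ A B → Hom ((A ⊗₀ B) ⊗₀ U) ((A ⊗₀ U) ⊗₀ B)
    exchange A B = α⇐ ∘ ((id ⊗₁ σ) ∘ α⇒)

    ⊗ᵤidᵤ : {f : HomR 𝒞 u A B} → f ⊗ᵤ idᵤ C ≈ (f ⊗₁ id) ∘ exchange A C
    ⊗ᵤidᵤ = ⊗-split₁ ⟩∘⟨ shuffle∘e⁻¹ ○ assoc ○ refl⟩∘⟨ (pullˡ α⇐-natʳ ○ assoc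
          ○ refl⟩∘⟨ (pullˡ (sym≈ ⊗-∘ʳ) ○ (refl⟩⊗⟨ id⊗e∘τ) ⟩∘⟨refl))

    e⊗id∘exchange : (e Y ⊗₁ id {Z}) ∘ exchange Y Z ≈ e (Y ⊗₀ Z)
    e⊗id∘exchange = pullˡ e⊗-∘α⇐ ○ pullˡ (sym≈ ⊗-∘ʳ)
                  ○ (refl⟩⊗⟨ (identityˡ ⟩∘⟨refl ○ assoc ○ λ⇒∘υ⊗id∘σ)) ⟩∘⟨refl ○ sym≈ e-assoc

    Jᵤ-⊗idᵤ : {x : Hom A B} → Jᵤ x ⊗ᵤ idᵤ C ≈ Jᵤ (x ⊗₁ id)
    Jᵤ-⊗idᵤ = ⊗ᵤidᵤ ○ ⊗-∘ˡ ⟩∘⟨refl ○ assoc ○ refl⟩∘⟨ e⊗id∘exchange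

  module Restriction {U V : Obj} (u : CentralIdem 𝒞 U) (v : CentralIdem 𝒞 V) (m : Hom U V)
                     (u≤v : _≤[_]_ 𝒞 u m v) where
    module Iu = CentralIdempotent u
    module Iv = CentralIdempotent v
    open Iu public using (_∘ᵤ_)
    open Iv using ()
      renaming (_∘ᵤ_ to _∘ᵥ_; idᵤ to idᵥ; _⊗ᵤ_ to _⊗ᵥ_; Jᵤ to Jᵥ)

    private
      variable
        A B X Y Z : Obj

    G : HomR 𝒞 v A B → HomR 𝒞 u A B
    G = G₁ 𝒞 u v m

    υᵥ∘m : Iv.υ ∘ m ≈ Iu.υ
    υᵥ∘m = sym≈ u≤v

    ιᵥ∘m : Iv.ι ∘ m ≈ (m ⊗₁ m) ∘ Iu.ι
    ιᵥ∘m = refl⟩∘⟨ sym≈ δᵥ∘m⊗m∘ιᵤ ○ sym-assoc ○ elimˡ Iv.ι∘δ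
      where
      δᵥ∘m⊗m∘ιᵤ : Iv.δ ∘ ((m ⊗₁ m) ∘ Iu.ι) ≈ m
      δᵥ∘m⊗m∘ιᵤ = begin
        (ρ⇒ ∘ (id ⊗₁ Iv.υ)) ∘ ((m ⊗₁ m) ∘ Iu.ι)  ≈⟨ assoc ○ refl⟩∘⟨ pullˡ (sym≈ ⊗-∘) ⟩
        ρ⇒ ∘ (((id ∘ m) ⊗₁ (Iv.υ ∘ m)) ∘ Iu.ι)   ≈⟨ refl⟩∘⟨ ((identityˡ ○ sym≈ identityʳ) ⟩⊗⟨ (υᵥ∘m ○ sym≈ identityˡ)) ⟩∘⟨refl ⟩
        ρ⇒ ∘ (((m ∘ id) ⊗₁ (id ∘ Iu.υ)) ∘ Iu.ι)  ≈⟨ refl⟩∘⟨ ⊗-∘ ⟩∘⟨refl ⟩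
        ρ⇒ ∘ (((m ⊗₁ id) ∘ (id ⊗₁ Iu.υ)) ∘ Iu.ι) ≈⟨ refl⟩∘⟨ assoc ○ pullˡ (sym≈ ρ-nat) ○ assoc ⟩
        m ∘ (ρ⇒ ∘ ((id ⊗₁ Iu.υ) ∘ Iu.ι))         ≈⟨ refl⟩∘⟨ sym-assoc ○ elimʳ Iu.δ∘ι ⟩
        m                                        ∎

    e⁻¹ᵥ∘id⊗m : Iv.e⁻¹ A ∘ (id ⊗₁ m) ≈ ((id ⊗₁ m) ⊗₁ m) ∘ Iu.e⁻¹ A
    e⁻¹ᵥ∘id⊗m = assoc ○ refl⟩∘⟨ (sym≈ ⊗-∘ʳ ○ (refl⟩⊗⟨ ιᵥ∘m) ○ ⊗-∘ʳ) ○ sym-assoc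
              ○ (sym≈ α⇐-nat ⟩∘⟨refl) ○ assoc

    G-∘ : {f : HomR 𝒞 v A B} {g : HomR 𝒞 v B X} → G (g ∘ᵥ f) ≈ G g ∘ᵤ G f
    G-∘ {f = f} {g} = begin
      (g ∘ ((f ⊗₁ id) ∘ Iv.e⁻¹ _)) ∘ (id ⊗₁ m)              ≈⟨ assoc ○ refl⟩∘⟨ (assoc ○ refl⟩∘⟨ e⁻¹ᵥ∘id⊗m) ⟩
      g ∘ ((f ⊗₁ id) ∘ (((id ⊗₁ m) ⊗₁ m) ∘ Iu.e⁻¹ _))        ≈⟨ refl⟩∘⟨ pullˡ (sym≈ ⊗-∘) ⟩
      g ∘ (((f ∘ (id ⊗₁ m)) ⊗₁ (id ∘ m)) ∘ Iu.e⁻¹ _)         ≈⟨ refl⟩∘⟨ ((sym≈ identityˡ ⟩⊗⟨ (identityˡ ○ sym≈ identityʳ)) ○ ⊗-∘) ⟩∘⟨refl ⟩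
      g ∘ (((id ⊗₁ m) ∘ ((f ∘ (id ⊗₁ m)) ⊗₁ id)) ∘ Iu.e⁻¹ _) ≈⟨ refl⟩∘⟨ assoc ○ sym-assoc ⟩
      (g ∘ (id ⊗₁ m)) ∘ (((f ∘ (id ⊗₁ m)) ⊗₁ id) ∘ Iu.e⁻¹ _) ∎

    Δₘ : Hom U (U ⊗₀ V)
    Δₘ = (id ⊗₁ m) ∘ Iu.ι

    eᵥ∘Δₘ : Iv.e U ∘ Δₘ ≈ id
    eᵥ∘Δₘ = pullˡ (assoc ○ refl⟩∘⟨ (sym≈ ⊗-∘ʳ ○ (refl⟩⊗⟨ υᵥ∘m))) ○ Iu.δ∘ι

    Δₘ∘eᵥ : Δₘ ∘ Iv.e U ≈ id
    Δₘ∘eᵥ = begin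
      ((id ⊗₁ m) ∘ Iu.ι) ∘ Iv.e U                                 ≈˘⟨ refl⟩∘⟨ elimʳ (sym≈ ⊗-∘ˡ ○ ⊗-elim Iu.δ∘ι refl≈) ⟩
      ((id ⊗₁ m) ∘ Iu.ι) ∘ (Iv.e U ∘ ((Iu.δ ⊗₁ id) ∘ (Iu.ι ⊗₁ id))) ≈⟨ refl⟩∘⟨ pullˡ (sym≈ Iv.e-natural) ⟩
      ((id ⊗₁ m) ∘ Iu.ι) ∘ ((Iu.δ ∘ Iv.e (U ⊗₀ U)) ∘ (Iu.ι ⊗₁ id)) ≈⟨ assoc ○ refl⟩∘⟨ (pullˡ (sym-assoc ○ elimˡ Iu.ι∘δ)) ⟩
      (id ⊗₁ m) ∘ (Iv.e (U ⊗₀ U) ∘ (Iu.ι ⊗₁ id))                   ≈⟨ refl⟩∘⟨ (Iv.e-assoc ⟩∘⟨refl ○ assoc) ⟩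
      (id ⊗₁ m) ∘ ((id ⊗₁ Iv.e U) ∘ (α⇒ ∘ (Iu.ι ⊗₁ id)))            ≈⟨ pullˡ (sym≈ ⊗-∘ʳ) ⟩
      (id ⊗₁ (m ∘ Iv.e U)) ∘ (α⇒ ∘ (Iu.ι ⊗₁ id))                   ≈⟨ (refl⟩⊗⟨ m∘eᵥ) ⟩∘⟨refl ⟩
      (id ⊗₁ (λ⇒ ∘ (Iu.υ ⊗₁ id))) ∘ (α⇒ ∘ (Iu.ι ⊗₁ id))            ≈⟨ ⊗-∘ʳ ⟩∘⟨refl ○ assoc ⟩
      (id ⊗₁ λ⇒) ∘ ((id ⊗₁ (Iu.υ ⊗₁ id)) ∘ (α⇒ ∘ (Iu.ι ⊗₁ id)))     ≈⟨ refl⟩∘⟨ pullˡ α-nat ⟩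
      (id ⊗₁ λ⇒) ∘ ((α⇒ ∘ ((id ⊗₁ Iu.υ) ⊗₁ id)) ∘ (Iu.ι ⊗₁ id))     ≈⟨ refl⟩∘⟨ assoc ○ pullˡ triangle ⟩
      (ρ⇒ ⊗₁ id) ∘ (((id ⊗₁ Iu.υ) ⊗₁ id) ∘ (Iu.ι ⊗₁ id))           ≈⟨ refl⟩∘⟨ sym≈ ⊗-∘ˡ ○ sym≈ ⊗-∘ˡ ⟩
      (ρ⇒ ∘ ((id ⊗₁ Iu.υ) ∘ Iu.ι)) ⊗₁ id                           ≈⟨ ⊗-elim (sym-assoc ○ Iu.δ∘ι) refl≈ ⟩
      id                                                           ∎
      where
      m∘eᵥ : m ∘ Iv.e U ≈ λ⇒ ∘ (Iu.υ ⊗₁ id)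
      m∘eᵥ = Iv.e-natural ○ (central v ⟩∘⟨refl) ○ assoc ○ refl⟩∘⟨ (sym≈ ⊗-∘ˡ ○ (υᵥ∘m ⟩⊗⟨refl))

    eᵥ⁻¹ : ∀ X → Hom (X ⊗₀ U) ((X ⊗₀ U) ⊗₀ V)
    eᵥ⁻¹ X = (id ⊗₁ m) ∘ Iu.e⁻¹ X

    eᵥ∘eᵥ⁻¹ : Iv.e (X ⊗₀ U) ∘ eᵥ⁻¹ X ≈ id
    eᵥ∘eᵥ⁻¹ = pullˡ (assoc ○ refl⟩∘⟨ (sym≈ ⊗-∘ʳ ○ (refl⟩⊗⟨ υᵥ∘m))) ○ Iu.e∘e⁻¹

    α⇒∘eᵥ⁻¹ : α⇒ ∘ eᵥ⁻¹ X ≈ id ⊗₁ Δₘ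
    α⇒∘eᵥ⁻¹ = pullˡ (sym≈ α-natʳ) ○ assoc ○ refl⟩∘⟨ cancelˡ α-isoʳ ○ sym≈ ⊗-∘ʳ

    eᵥ⁻¹∘eᵥ : eᵥ⁻¹ X ∘ Iv.e (X ⊗₀ U) ≈ id
    eᵥ⁻¹∘eᵥ = split-mono α-isoˡ (begin
      α⇒ ∘ (eᵥ⁻¹ _ ∘ Iv.e _)                 ≈⟨ pullˡ α⇒∘eᵥ⁻¹ ○ refl⟩∘⟨ Iv.e-assoc ⟩
      (id ⊗₁ Δₘ) ∘ ((id ⊗₁ Iv.e U) ∘ α⇒)     ≈⟨ pullˡ (sym≈ ⊗-∘ʳ) ○ elimˡ (⊗-elim refl≈ Δₘ∘eᵥ) ⟩
      α⇒                                      ≈˘⟨ identityʳ ⟩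
      α⇒ ∘ id                                 ∎)

    unit : ∀ X → HomR 𝒞 u X (X ⊗₀ U)
    unit = adj-unit 𝒞 u v m

    ladjunct : HomR 𝒞 v (X ⊗₀ U) Y → HomR 𝒞 u X Y
    ladjunct {X} h = h ∘ eᵥ⁻¹ X

    ladjunct-injective : {h h' : HomR 𝒞 v (X ⊗₀ U) Y} → ladjunct h ≈ ladjunct h' → h ≈ h'
    ladjunct-injective = split-epi eᵥ⁻¹∘eᵥ

    ladjunct≈G∘unit : {h : HomR 𝒞 v (X ⊗₀ U) Y} → ladjunct h ≈ G h ∘ᵤ unit X
    ladjunct≈G∘unit = sym≈ (refl⟩∘⟨ elimˡ ⊗-id ○ assoc)

    ladjunct-∘ : {h : HomR 𝒞 v (X ⊗₀ U) Y} {g : HomR 𝒞 v Y Z} →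
                 ladjunct (g ∘ᵥ h) ≈ G g ∘ᵤ ladjunct h
    ladjunct-∘ = ladjunct≈G∘unit ○ Iu.∘ᵤ-resp-≈ G-∘ refl≈ ○ Iu.∘ᵤ-assoc
               ○ Iu.∘ᵤ-resp-≈ refl≈ (sym≈ ladjunct≈G∘unit)

    ladjunct-Jᵥ : {x : Hom (X ⊗₀ U) Y} → ladjunct (Jᵥ x) ≈ x
    ladjunct-Jᵥ = assoc ○ elimʳ eᵥ∘eᵥ⁻¹

    ladjunct-Jᵥ-∘ᵥ : {x : Hom Y Z} {g : HomR 𝒞 v (X ⊗₀ U) Y} → ladjunct (Jᵥ x ∘ᵥ g) ≈ x ∘ ladjunct g
    ladjunct-Jᵥ-∘ᵥ = Iv.Jᵤ-∘ᵤ ⟩∘⟨refl ○ assoc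

    ladjunct-idᵥ⊗ᵥ : {W : Obj} {k : HomR 𝒞 v U W} → ladjunct (idᵥ X ⊗ᵥ k) ≈ id ⊗₁ (k ∘ Δₘ)
    ladjunct-idᵥ⊗ᵥ = Iv.idᵤ⊗ᵤ ⟩∘⟨refl ○ assoc ○ refl⟩∘⟨ α⇒∘eᵥ⁻¹ ○ sym≈ ⊗-∘ʳ

    Jᵥ-reflects-≤ : {W : Obj} (w : CentralIdem 𝒞 W) (k : HomR 𝒞 v U W) →
                    Jᵥ (mor u) ≈ Jᵥ (mor w) ∘ᵥ k → _≤[_]_ 𝒞 u (k ∘ Δₘ) w
    Jᵥ-reflects-≤ w k u≈w∘k = sym≈ (elimʳ eᵥ∘Δₘ) ○ sym-assoc ○ (u≈w∘k ○ Iv.Jᵤ-∘ᵤ) ⟩∘⟨refl ○ assoc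

    exchange∘eᵥ⁻¹ : Iv.exchange X U ∘ eᵥ⁻¹ X ≈ ((id ⊗₁ m) ⊗₁ id) ∘ Iu.e⁻¹ X
    exchange∘eᵥ⁻¹ = begin
      (α⇐ ∘ ((id ⊗₁ σ) ∘ α⇒)) ∘ eᵥ⁻¹ _          ≈⟨ assoc ○ refl⟩∘⟨ (assoc ○ refl⟩∘⟨ α⇒∘eᵥ⁻¹) ⟩
      α⇐ ∘ ((id ⊗₁ σ) ∘ (id ⊗₁ Δₘ))             ≈⟨ refl⟩∘⟨ (sym≈ ⊗-∘ʳ ○ (refl⟩⊗⟨ σ∘Δₘ) ○ ⊗-∘ʳ) ⟩
      α⇐ ∘ ((id ⊗₁ (m ⊗₁ id)) ∘ (id ⊗₁ Iu.ι))   ≈⟨ pullˡ (sym≈ α⇐-nat) ○ assoc ⟩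
      ((id ⊗₁ m) ⊗₁ id) ∘ (α⇐ ∘ (id ⊗₁ Iu.ι))   ∎
      where
      σ∘Δₘ : σ ∘ Δₘ ≈ (m ⊗₁ id) ∘ Iu.ι
      σ∘Δₘ = pullˡ (sym≈ σ-nat) ○ assoc ○ refl⟩∘⟨ Iu.σ∘ι

    ladjunct-⊗ᵥidᵥ : {f : HomR 𝒞 v X Y} → ladjunct (f ⊗ᵥ idᵥ U) ≈ unit Y ∘ᵤ G f
    ladjunct-⊗ᵥidᵥ = Iv.⊗ᵤidᵤ ⟩∘⟨refl ○ assoc ○ refl⟩∘⟨ exchange∘eᵥ⁻¹ ○ pullˡ (sym≈ ⊗-∘ˡ)
                   ○ sym≈ identityˡ

    ladjunct-∘⊗ᵥidᵥ : {f : HomR 𝒞 v X Y} {h : HomR 𝒞 v (Y ⊗₀ U) Z} →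
                      ladjunct (h ∘ᵥ (f ⊗ᵥ idᵥ U)) ≈ ladjunct h ∘ᵤ G f
    ladjunct-∘⊗ᵥidᵥ = ladjunct-∘ ○ Iu.∘ᵤ-resp-≈ refl≈ ladjunct-⊗ᵥidᵥ ○ sym≈ Iu.∘ᵤ-assoc
                    ○ Iu.∘ᵤ-resp-≈ (sym≈ ladjunct≈G∘unit) refl≈

    counit∘F≈Jᵥ : (x : HomR 𝒞 u X Y) → adj-counit 𝒞 u v m Y ∘ᵥ F₁ 𝒞 u v m x ≈ Jᵥ x
    counit∘F≈Jᵥ x = Iv.Jᵤ-∘ᵤ ○ pullˡ (sym≈ Iu.e-natural) ○ assoc ○ refl⟩∘⟨ cancelˡ Iu.e∘e⁻¹

  module Meet {U W : Obj} (u : CentralIdem 𝒞 U) (w : CentralIdem 𝒞 W) (uw : CentralIdem 𝒞 (U ⊗₀ W))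
              (uw≈u⊗w : mor uw ≈ λ⇒ ∘ (mor u ⊗₁ mor w)) where
    module Iw = CentralIdempotent w
    module Iuw = CentralIdempotent uw
    open Iuw using (_∘ᵤ_)

    π₁ : Hom (U ⊗₀ W) U
    π₁ = _⊗u_ 𝒞 U w

    π₂ : Hom (U ⊗₀ W) W
    π₂ = λ⇒ ∘ (mor u ⊗₁ id)

    uw≤u : _≤[_]_ 𝒞 uw π₁ u
    uw≤u = uw≈u⊗w ○ (sym≈ ρ⇒I≈λ⇒I ⟩∘⟨ ⊗-split₁) ○ sym-assoc ○ (sym≈ ρ-nat ⟩∘⟨refl) ○ assoc

    uw≤w : _≤[_]_ 𝒞 uw π₂ w
    uw≤w = uw≈u⊗w ○ (refl⟩∘⟨ ⊗-split₂) ○ sym-assoc ○ (sym≈ λ-nat ⟩∘⟨refl) ○ assoc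

    π₁⊗π₂∘ι : (π₁ ⊗₁ π₂) ∘ Iuw.ι ≈ id
    π₁⊗π₂∘ι = π₁⊗π₂≈δ ⟩∘⟨refl ○ Iuw.δ∘ι
      where
      π₁⊗π₂≈δ : π₁ ⊗₁ π₂ ≈ Iuw.δ
      π₁⊗π₂≈δ = ⊗-split₁ ○ (Iw.e⊗id≈e ⟩∘⟨refl) ○ assoc ○ refl⟩∘⟨ (sym≈ ⊗-∘ʳ
              ○ (refl⟩⊗⟨ (pullˡ λ-nat ○ assoc ○ refl⟩∘⟨ sym≈ ⊗-split₂ ○ sym≈ uw≈u⊗w)))

    Gπ₂∘Gπ₁ : {Z Y X : Obj} (y : Hom (Z ⊗₀ U) Y) (x : Hom (Y ⊗₀ W) X) →
            G₁ 𝒞 uw w π₂ x ∘ᵤ G₁ 𝒞 uw u π₁ y ≈ x ∘ ((y ⊗₁ id) ∘ α⇐)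
    Gπ₂∘Gπ₁ y x = assoc ○ refl⟩∘⟨ (pullˡ (sym≈ ⊗-split₂ ○ (refl⟩⊗⟨ sym≈ identityˡ) ○ ⊗-∘) ○ assoc
              ○ refl⟩∘⟨ (pullˡ α⇐-nat ○ assoc ○ refl⟩∘⟨ (sym≈ ⊗-∘ʳ ○ ⊗-elim refl≈ π₁⊗π₂∘ι) ○ identityʳ))

  module Transport where
    module _ {U : Obj} (u : CentralIdem 𝒞 U) where
      private
        variable
          A A' A'' B B' B'' C C' : Obj

        subst : A ≡ A' → B ≡ B' → HomR 𝒞 u A B → HomR 𝒞 u A' B'
        subst = substR 𝒞 u

      subst-∘ : (p : A ≡ A') (q q' : B ≡ B') (r : C ≡ C') {g : HomR 𝒞 u B C} {f : HomR 𝒞 u A B} →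
                _∘R_ 𝒞 u (subst q' r g) (subst p q f) ≡ subst p r (_∘R_ 𝒞 u g f)
      subst-∘ refl refl refl refl = refl

      subst-resp-≈ : (p : A ≡ A') (q : B ≡ B') {f g : HomR 𝒞 u A B} → f ≈ g → subst p q f ≈ subst p q g
      subst-resp-≈ refl refl f≈g = f≈g

      subst-id : (p p' : A ≡ A') → subst p p' (idR 𝒞 u A) ≡ idR 𝒞 u A'
      subst-id refl refl = refl

      subst-irrelevant : (p p' : A ≡ A') (q q' : B ≡ B') {f : HomR 𝒞 u A B} → subst p q f ≡ subst p' q' f
      subst-irrelevant refl refl refl refl = refl

      subst-trans : (p : A ≡ A') (p' : A' ≡ A'') (q : B ≡ B') (q' : B' ≡ B'') {f : HomR 𝒞 u A B} →
                    subst p' q' (subst p q f) ≡ subst (trans p p') (trans q q') f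
      subst-trans refl refl refl refl = refl

      T₁-subst : (T : MonadR 𝒞 u) (p : A ≡ A') (q : B ≡ B') {f : HomR 𝒞 u A B} →
                 MonadR.T₁ T (subst p q f)
                   ≡ subst (cong (MonadR.T₀ T) p) (cong (MonadR.T₀ T) q) (MonadR.T₁ T f)
      T₁-subst T refl refl = refl

    module _ {U V : Obj} (u : CentralIdem 𝒞 U) (v : CentralIdem 𝒞 V) (m : Hom U V) where
      G-subst : {A A' B B' : Obj} (p : A ≡ A') (q : B ≡ B') {f : HomR 𝒞 v A B} →
                G₁ 𝒞 u v m (substR 𝒞 v p q f) ≡ substR 𝒞 u p q (G₁ 𝒞 u v m f)
      G-subst refl refl = refl

      F-subst : {A A' B B' : Obj} (p : A ≡ A') (q : B ≡ B') {x : HomR 𝒞 u A B} →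
                substR 𝒞 v (cong (_⊗₀ U) p) (cong (_⊗₀ U) q) (F₁ 𝒞 u v m x)
                  ≡ F₁ 𝒞 u v m (substR 𝒞 u p q x)
      F-subst refl refl = refl

  module RestrictedMonad (M : FormalMonad 𝒞) {U V : Obj} (u : CentralIdem 𝒞 U) (v : CentralIdem 𝒞 V)
                         (m : Hom U V) (u≤v : _≤[_]_ 𝒞 u m v) where
    open FormalMonad M
    open Transport

    open Restriction u v m u≤v public
    open Iu using (idᵤ)
    open Iv using () renaming (_∘ᵤ_ to _∘ᵥ_; idᵤ to idᵥ; _⊗ᵤ_ to _⊗ᵥ_; Jᵤ to Jᵥ)

    private
      variable
        A B C : Obj

      Tu≡Tv : ∀ A → TM.T₀ u A ≡ TM.T₀ v A
      Tu≡Tv = compat₀ u v m u≤v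

      TuTu≡TvTv : ∀ A → TM.T₀ u (TM.T₀ u A) ≡ TM.T₀ v (TM.T₀ v A)
      TuTu≡TvTv A = trans (Tu≡Tv (TM.T₀ u A)) (cong (TM.T₀ v) (Tu≡Tv A))

    Tu₁ : HomR 𝒞 u A B → HomR 𝒞 u (TM.T₀ v A) (TM.T₀ v B)
    Tu₁ {A} {B} f = substR 𝒞 u (Tu≡Tv A) (Tu≡Tv B) (TM.T₁ u f)

    ηu : ∀ A → HomR 𝒞 u A (TM.T₀ v A)
    ηu A = substR 𝒞 u refl (Tu≡Tv A) (TM.η u A)

    μu : ∀ A → HomR 𝒞 u (TM.T₀ v (TM.T₀ v A)) (TM.T₀ v A)
    μu A = substR 𝒞 u (TuTu≡TvTv A) (Tu≡Tv A) (TM.μ u A)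

    Tu-resp-≈ : {f g : HomR 𝒞 u A B} → f ≈ g → Tu₁ f ≈ Tu₁ g
    Tu-resp-≈ f≈g = subst-resp-≈ u _ _ (TM.T-resp u f≈g)

    Tu-id : Tu₁ (idᵤ A) ≈ idᵤ (TM.T₀ v A)
    Tu-id {A} = subst-resp-≈ u (Tu≡Tv A) (Tu≡Tv A) (TM.T-id u) ○ ≡⇒≈ (subst-id u (Tu≡Tv A) (Tu≡Tv A))

    Tu-∘ : {f : HomR 𝒞 u A B} {g : HomR 𝒞 u B C} → Tu₁ (g ∘ᵤ f) ≈ Tu₁ g ∘ᵤ Tu₁ f
    Tu-∘ {A} {B} {C} = subst-resp-≈ u (Tu≡Tv A) (Tu≡Tv C) (TM.T-∘ u)
                     ○ ≡⇒≈ (sym (subst-∘ u (Tu≡Tv A) (Tu≡Tv B) (Tu≡Tv B) (Tu≡Tv C)))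

    ηu-natural : (f : HomR 𝒞 u A B) → Tu₁ f ∘ᵤ ηu A ≈ ηu B ∘ᵤ f
    ηu-natural {A} {B} f = ≡⇒≈ (subst-∘ u refl (Tu≡Tv A) (Tu≡Tv A) (Tu≡Tv B))
                         ○ subst-resp-≈ u refl (Tu≡Tv B) (TM.η-nat u f)
                         ○ ≡⇒≈ (sym (subst-∘ u refl refl refl (Tu≡Tv B)))

    μu-natural : (f : HomR 𝒞 u A B) → Tu₁ f ∘ᵤ μu A ≈ μu B ∘ᵤ Tu₁ (Tu₁ f)
    μu-natural {A} {B} f = ≡⇒≈ (subst-∘ u (TuTu≡TvTv A) (Tu≡Tv A) (Tu≡Tv A) (Tu≡Tv B))
                         ○ subst-resp-≈ u (TuTu≡TvTv A) (Tu≡Tv B) (TM.μ-nat u f)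
                         ○ ≡⇒≈ (subst-irrelevant u (TuTu≡TvTv A) TuTuA≡TvTvA (Tu≡Tv B) (Tu≡Tv B))
                         ○ ≡⇒≈ (sym (subst-∘ u TuTuA≡TvTvA TuTuB≡TvTvB (TuTu≡TvTv B) (Tu≡Tv B)))
                         ○ Iu.∘ᵤ-resp-≈ refl≈ (≡⇒≈ (sym Tu₁Tu₁≡subst-T₁T₁))
      where
      TuTuA≡TvTvA : TM.T₀ u (TM.T₀ u A) ≡ TM.T₀ v (TM.T₀ v A)
      TuTuA≡TvTvA = trans (cong (TM.T₀ u) (Tu≡Tv A)) (Tu≡Tv (TM.T₀ v A))
      TuTuB≡TvTvB : TM.T₀ u (TM.T₀ u B) ≡ TM.T₀ v (TM.T₀ v B)
      TuTuB≡TvTvB = trans (cong (TM.T₀ u) (Tu≡Tv B)) (Tu≡Tv (TM.T₀ v B))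
      Tu₁Tu₁≡subst-T₁T₁ : Tu₁ (Tu₁ f) ≡ substR 𝒞 u TuTuA≡TvTvA TuTuB≡TvTvB (TM.T₁ u (TM.T₁ u f))
      Tu₁Tu₁≡subst-T₁T₁ =
        trans (cong (substR 𝒞 u (Tu≡Tv (TM.T₀ v A)) (Tu≡Tv (TM.T₀ v B))) (T₁-subst u (T u) (Tu≡Tv A) (Tu≡Tv B)))
              (subst-trans u (cong (TM.T₀ u) (Tu≡Tv A)) (Tu≡Tv (TM.T₀ v A))
                             (cong (TM.T₀ u) (Tu≡Tv B)) (Tu≡Tv (TM.T₀ v B)))

    Tu∘G≈G∘Tv : (f : HomR 𝒞 v A B) → Tu₁ (G f) ≈ G (TM.T₁ v f)
    Tu∘G≈G∘Tv = compat₁ u v m u≤v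

    ηu≈Gηv : ∀ A → ηu A ≈ G (TM.η v A)
    ηu≈Gηv = compat-η u v m u≤v

    μu≈Gμv : ∀ A → μu A ≈ G (TM.μ v A)
    μu≈Gμv = compat-μ u v m u≤v

    st : ∀ A → HomR 𝒞 v (TM.T₀ v A ⊗₀ U) (TM.T₀ v (A ⊗₀ U))
    st = prop-strength 𝒞 M v u m u≤v

    st≈Jᵥ : ∀ A → st A ≈ Jᵥ (Tu₁ (unit A))
    st≈Jᵥ A = ≡⇒≈ (cong (_∘R_ 𝒞 v (adj-counit 𝒞 u v m (TM.T₀ v (A ⊗₀ U))))
                        (F-subst u v m (Tu≡Tv A) (Tu≡Tv (A ⊗₀ U))))
            ○ counit∘F≈Jᵥ (Tu₁ (unit A))

    ladjunct-st : ∀ A → ladjunct (st A) ≈ Tu₁ (unit A)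
    ladjunct-st A = st≈Jᵥ A ⟩∘⟨refl ○ ladjunct-Jᵥ

    ladjunct-T₁∘st : (h : HomR 𝒞 v (A ⊗₀ U) B) → ladjunct (TM.T₁ v h ∘ᵥ st A) ≈ Tu₁ (ladjunct h)
    ladjunct-T₁∘st {A} h = ladjunct-∘ ○ Iu.∘ᵤ-resp-≈ (sym≈ (Tu∘G≈G∘Tv h)) (ladjunct-st A) ○ sym≈ Tu-∘
                         ○ Tu-resp-≈ (sym≈ ladjunct≈G∘unit)

    ladjunct-st∘⊗ᵥidᵥ : (f : HomR 𝒞 v A (TM.T₀ v B)) → ladjunct (st B ∘ᵥ (f ⊗ᵥ idᵥ U)) ≈ Tu₁ (unit B) ∘ᵤ G f
    ladjunct-st∘⊗ᵥidᵥ {B = B} f = ladjunct-∘⊗ᵥidᵥ ○ Iu.∘ᵤ-resp-≈ (ladjunct-st B) refl≈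

  module _ (M : FormalMonad 𝒞) where
    open FormalMonad M
    open Transport

    Tu∘G≈G∘Tw : ∀ {U W V} (u : CentralIdem 𝒞 U) (w : CentralIdem 𝒞 W) (v : CentralIdem 𝒞 V)
      (k : Hom U W) (u≤w : _≤[_]_ 𝒞 u k w) (m : Hom U V) (u≤v : _≤[_]_ 𝒞 u m v)
      (n : Hom W V) (w≤v : _≤[_]_ 𝒞 w n v) {A B} (f : HomR 𝒞 w A B) →
      RestrictedMonad.Tu₁ M u v m u≤v (G₁ 𝒞 u w k f) ≈ G₁ 𝒞 u w k (RestrictedMonad.Tu₁ M w v n w≤v f)
    Tu∘G≈G∘Tw u w v k u≤w m u≤v n w≤v {A} {B} f =
      ≡⇒≈ (subst-irrelevant u (Tu≡Tv A) (trans (Tu≡Tw A) (Tw≡Tv A)) (Tu≡Tv B) (trans (Tu≡Tw B) (Tw≡Tv B)))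
      ○ ≡⇒≈ (sym (subst-trans u (Tu≡Tw A) (Tw≡Tv A) (Tu≡Tw B) (Tw≡Tv B)))
      ○ subst-resp-≈ u (Tw≡Tv A) (Tw≡Tv B) (compat₁ u w k u≤w f)
      ○ ≡⇒≈ (sym (G-subst u w k (Tw≡Tv A) (Tw≡Tv B)))
      where
      Tu≡Tv : ∀ X → TM.T₀ u X ≡ TM.T₀ v X
      Tu≡Tv = compat₀ u v m u≤v
      Tw≡Tv : ∀ X → TM.T₀ w X ≡ TM.T₀ v X
      Tw≡Tv = compat₀ w v n w≤v
      Tu≡Tw : ∀ X → TM.T₀ u X ≡ TM.T₀ w X
      Tu≡Tw = compat₀ u w k u≤w

  module Localisability (M : FormalMonad 𝒞) {V : Obj} (v : CentralIdem 𝒞 V) where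
    open CentralIdempotent v using () renaming (_∘ᵤ_ to _∘ᵥ_; idᵤ to idᵥ; _⊗ᵤ_ to _⊗ᵥ_; Jᵤ to Jᵥ)
    open MonadR (FormalMonad.T M v)

    private
      strength : ∀ {U} (u : CentralIdem 𝒞 U) (m : Hom U V) → _≤[_]_ 𝒞 u m v → ∀ A →
           HomR 𝒞 v (T₀ A ⊗₀ U) (T₀ (A ⊗₀ U))
      strength = prop-strength 𝒞 M v

    ρᵥ : ∀ X → HomR 𝒞 v (X ⊗₀ V) X
    ρᵥ X = Jᵥ ρ⇒ ∘ᵥ (idᵥ X ⊗ᵥ Jᵥ (mor v))

    v≤v : _≤[_]_ 𝒞 v id v
    v≤v = sym≈ identityʳ

    ladjunct-ρᵥ : ∀ X → RestrictedMonad.ladjunct M v v id v≤v (ρᵥ X) ≈ idᵥ X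
    ladjunct-ρᵥ X = ladjunct-Jᵥ-∘ᵥ ○ refl⟩∘⟨ (ladjunct-idᵥ⊗ᵥ ○ (refl⟩⊗⟨ (assoc ○ elimʳ eᵥ∘Δₘ)))
      where open RestrictedMonad M v v id v≤v

    st-unit : ∀ A → T₁ (ρᵥ A) ∘ᵥ strength v id v≤v A ≈ ρᵥ (T₀ A)
    st-unit A = ladjunct-injective (begin
      ladjunct (T₁ (ρᵥ A) ∘ᵥ strength v id v≤v A) ≈⟨ ladjunct-T₁∘st (ρᵥ A) ⟩
      Tu₁ (ladjunct (ρᵥ A))                 ≈⟨ Tu-resp-≈ (ladjunct-ρᵥ A) ○ Tu-id ⟩
      idᵥ (T₀ A)                             ≈˘⟨ ladjunct-ρᵥ (T₀ A) ⟩
      ladjunct (ρᵥ (T₀ A))                   ∎)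
      where open RestrictedMonad M v v id v≤v

    st-η : ∀ {U} (u : CentralIdem 𝒞 U) (m : Hom U V) (u≤v : _≤[_]_ 𝒞 u m v) A →
           η (A ⊗₀ U) ≈ strength u m u≤v A ∘ᵥ (η A ⊗ᵥ idᵥ U)
    st-η {U} u m u≤v A = ladjunct-injective (begin
      ladjunct (η (A ⊗₀ U))                 ≈⟨ ladjunct≈G∘unit ⟩
      G (η (A ⊗₀ U)) ∘ᵤ unit A              ≈˘⟨ Iu.∘ᵤ-resp-≈ (ηu≈Gηv (A ⊗₀ U)) refl≈ ⟩
      ηu (A ⊗₀ U) ∘ᵤ unit A                 ≈˘⟨ ηu-natural (unit A) ⟩
      Tu₁ (unit A) ∘ᵤ ηu A                  ≈⟨ Iu.∘ᵤ-resp-≈ refl≈ (ηu≈Gηv A) ⟩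
      Tu₁ (unit A) ∘ᵤ G (η A)               ≈˘⟨ ladjunct-st∘⊗ᵥidᵥ (η A) ⟩
      ladjunct (strength u m u≤v A ∘ᵥ (η A ⊗ᵥ idᵥ U)) ∎)
      where open RestrictedMonad M u v m u≤v

    st-μ : ∀ {U} (u : CentralIdem 𝒞 U) (m : Hom U V) (u≤v : _≤[_]_ 𝒞 u m v) A →
           μ (A ⊗₀ U) ∘ᵥ (T₁ (strength u m u≤v A) ∘ᵥ strength u m u≤v (T₀ A)) ≈ strength u m u≤v A ∘ᵥ (μ A ⊗ᵥ idᵥ U)
    st-μ {U} u m u≤v A = ladjunct-injective (begin
      ladjunct (μ (A ⊗₀ U) ∘ᵥ (T₁ (strength u m u≤v A) ∘ᵥ strength u m u≤v (T₀ A)))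
        ≈⟨ ladjunct-∘ ○ Iu.∘ᵤ-resp-≈ (sym≈ (μu≈Gμv (A ⊗₀ U))) (ladjunct-T₁∘st (strength u m u≤v A)) ⟩
      μu (A ⊗₀ U) ∘ᵤ Tu₁ (ladjunct (strength u m u≤v A)) ≈⟨ Iu.∘ᵤ-resp-≈ refl≈ (Tu-resp-≈ (ladjunct-st A)) ⟩
      μu (A ⊗₀ U) ∘ᵤ Tu₁ (Tu₁ (unit A))             ≈˘⟨ μu-natural (unit A) ⟩
      Tu₁ (unit A) ∘ᵤ μu A                          ≈⟨ Iu.∘ᵤ-resp-≈ refl≈ (μu≈Gμv A) ⟩
      Tu₁ (unit A) ∘ᵤ G (μ A)                       ≈˘⟨ ladjunct-st∘⊗ᵥidᵥ (μ A) ⟩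
      ladjunct (strength u m u≤v A ∘ᵥ (μ A ⊗ᵥ idᵥ U))     ∎)
      where open RestrictedMonad M u v m u≤v

    st-nat : ∀ {U} (u : CentralIdem 𝒞 U) (m : Hom U V) (u≤v : _≤[_]_ 𝒞 u m v) {A B} (f : HomR 𝒞 v A B) →
             strength u m u≤v B ∘ᵥ (T₁ f ⊗ᵥ idᵥ U) ≈ T₁ (f ⊗ᵥ idᵥ U) ∘ᵥ strength u m u≤v A
    st-nat {U} u m u≤v {A} {B} f = ladjunct-injective (begin
      ladjunct (strength u m u≤v B ∘ᵥ (T₁ f ⊗ᵥ idᵥ U)) ≈⟨ ladjunct-st∘⊗ᵥidᵥ (T₁ f) ⟩
      Tu₁ (unit B) ∘ᵤ G (T₁ f)                   ≈˘⟨ Tu-∘ ○ Iu.∘ᵤ-resp-≈ refl≈ (Tu∘G≈G∘Tv f) ⟩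
      Tu₁ (unit B ∘ᵤ G f)                        ≈˘⟨ Tu-resp-≈ ladjunct-⊗ᵥidᵥ ⟩
      Tu₁ (ladjunct (f ⊗ᵥ idᵥ U))                ≈˘⟨ ladjunct-T₁∘st (f ⊗ᵥ idᵥ U) ⟩
      ladjunct (T₁ (f ⊗ᵥ idᵥ U) ∘ᵥ strength u m u≤v A) ∎)
      where open RestrictedMonad M u v m u≤v

    st-le : ∀ {U W} (u : CentralIdem 𝒞 U) (w : CentralIdem 𝒞 W)
            (m : Hom U V) (u≤v : _≤[_]_ 𝒞 u m v) (n : Hom W V) (w≤v : _≤[_]_ 𝒞 w n v)
            (k : HomR 𝒞 v U W) → Jᵥ (mor u) ≈ Jᵥ (mor w) ∘ᵥ k → ∀ A →
            strength w n w≤v A ∘ᵥ (idᵥ (T₀ A) ⊗ᵥ k) ≈ T₁ (idᵥ A ⊗ᵥ k) ∘ᵥ strength u m u≤v A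
    st-le u w m u≤v n w≤v k u≈w∘k A = ladjunct-injective (begin
      ladjunct (strength w n w≤v A ∘ᵥ (idᵥ (T₀ A) ⊗ᵥ k))
        ≈⟨ Iv.∘ᵤ-resp-≈ (Sw.st≈Jᵥ A) refl≈ ⟩∘⟨refl ○ ladjunct-Jᵥ-∘ᵥ ○ refl⟩∘⟨ ladjunct-idᵥ⊗ᵥ ⟩
      G₁ 𝒞 u w (k ∘ Δₘ) (Sw.Tu₁ (Sw.unit A))
        ≈˘⟨ Tu∘G≈G∘Tw M u w v (k ∘ Δₘ) (Jᵥ-reflects-≤ w k u≈w∘k) m u≤v n w≤v (Sw.unit A) ⟩
      Tu₁ (G₁ 𝒞 u w (k ∘ Δₘ) (Sw.unit A))       ≈˘⟨ Tu-resp-≈ (ladjunct-idᵥ⊗ᵥ ○ sym≈ identityˡ) ⟩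
      Tu₁ (ladjunct (idᵥ A ⊗ᵥ k))               ≈˘⟨ ladjunct-T₁∘st (idᵥ A ⊗ᵥ k) ⟩
      ladjunct (T₁ (idᵥ A ⊗ᵥ k) ∘ᵥ strength u m u≤v A) ∎)
      where
      open RestrictedMonad M u v m u≤v
      module Sw = RestrictedMonad M w v n w≤v

    st-assoc : ∀ {U W} (u : CentralIdem 𝒞 U) (w : CentralIdem 𝒞 W)
               (uw : CentralIdem 𝒞 (U ⊗₀ W)) → mor uw ≈ λ⇒ ∘ (mor u ⊗₁ mor w) →
               (m : Hom U V) (u≤v : _≤[_]_ 𝒞 u m v) (n : Hom W V) (w≤v : _≤[_]_ 𝒞 w n v)
               (p : Hom (U ⊗₀ W) V) (uw≤v : _≤[_]_ 𝒞 uw p v) → ∀ A →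
               T₁ (Jᵥ α⇐) ∘ᵥ strength uw p uw≤v A
                 ≈ strength w n w≤v (A ⊗₀ U) ∘ᵥ ((strength u m u≤v A ⊗ᵥ idᵥ W) ∘ᵥ Jᵥ α⇐)
    st-assoc {U} {W} u w uw uw≈u⊗w m u≤v n w≤v p uw≤v A = ladjunct-injective (begin
      ladjunct (T₁ (Jᵥ α⇐) ∘ᵥ strength uw p uw≤v A)   ≈⟨ ladjunct-T₁∘st (Jᵥ α⇐) ○ Tu-resp-≈ ladjunct-Jᵥ ⟩
      Tu₁ α⇐                                          ≈˘⟨ Tu-resp-≈ (Gπ₂∘Gπ₁ id id ○ identityˡ ○ elimˡ ⊗-id) ⟩
      Tu₁ (G₁ 𝒞 uw w π₂ (Sw.unit (A ⊗₀ U)) ∘ᵤ G₁ 𝒞 uw u π₁ (Su.unit A))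
        ≈⟨ Tu-∘ ○ Iu.∘ᵤ-resp-≈ (Tu∘G≈G∘Tw M uw w v π₂ uw≤w p uw≤v n w≤v (Sw.unit (A ⊗₀ U)))
                               (Tu∘G≈G∘Tw M uw u v π₁ uw≤u p uw≤v m u≤v (Su.unit A)) ⟩
      G₁ 𝒞 uw w π₂ x ∘ᵤ G₁ 𝒞 uw u π₁ y                 ≈⟨ Gπ₂∘Gπ₁ y x ⟩
      x ∘ ((y ⊗₁ id) ∘ α⇐)
        ≈˘⟨ refl⟩∘⟨ (Iv.∘ᵤ-resp-≈ Iv.Jᵤ-⊗idᵤ refl≈ ⟩∘⟨refl ○ ladjunct-Jᵥ-∘ᵥ ○ refl⟩∘⟨ ladjunct-Jᵥ) ⟩
      x ∘ ladjunct ((Jᵥ y ⊗ᵥ idᵥ W) ∘ᵥ Jᵥ α⇐)        ≈˘⟨ ladjunct-Jᵥ-∘ᵥ ⟩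
      ladjunct (Jᵥ x ∘ᵥ ((Jᵥ y ⊗ᵥ idᵥ W) ∘ᵥ Jᵥ α⇐))
        ≈˘⟨ Iv.∘ᵤ-resp-≈ (Sw.st≈Jᵥ (A ⊗₀ U)) (Iv.∘ᵤ-resp-≈ ((Su.st≈Jᵥ A ⟩⊗⟨refl) ⟩∘⟨refl) refl≈) ⟩∘⟨refl ⟩
      ladjunct (strength w n w≤v (A ⊗₀ U) ∘ᵥ ((strength u m u≤v A ⊗ᵥ idᵥ W) ∘ᵥ Jᵥ α⇐)) ∎)
      where
      open RestrictedMonad M uw v p uw≤v
      open Meet u w uw uw≈u⊗w using (π₁; π₂; uw≤u; uw≤w; Gπ₂∘Gπ₁)
      module Su = RestrictedMonad M u v m u≤v
      module Sw = RestrictedMonad M w v n w≤v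
      x : Hom (T₀ (A ⊗₀ U) ⊗₀ W) (T₀ ((A ⊗₀ U) ⊗₀ W))
      x = Sw.Tu₁ (Sw.unit (A ⊗₀ U))
      y : Hom (T₀ A ⊗₀ U) (T₀ (A ⊗₀ U))
      y = Su.Tu₁ (Su.unit A)

proposition4p4 : ∀ {o ℓ e : Level} (𝒞 : SymMonCat o ℓ e) → Stiff 𝒞 →
    (M : FormalMonad 𝒞) → ∀ {V} (v : CentralIdem 𝒞 V) →
    IsLocalisable 𝒞 v (FormalMonad.T M v) (prop-strength 𝒞 M v)
proposition4p4 𝒞 _ M v = record
  { st-unit  = st-unit
  ; st-assoc = st-assoc
  ; st-η     = st-η
  ; st-μ     = st-μ
  ; st-le    = st-le
  ; st-nat   = st-nat
  }
  where open Localisability M v
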